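{- Let $G$ be a graph with no efficient dominating set. Then $|V(G)|\leq\gamma(G)(\Delta(G)+1)-1$. (i) Suppose equality holds. Then (a) for every $\gamma$-set $D$ of $G$ there is exactly one vertex $y_D\in V(G)\setminus D$ such that $D$ is an efficient dominating set of $G-y_D$, and $y_D$ is adjacent to exactly $2$ vertices of $D$; and (b) every vertex belonging to some $\gamma$-set of $G$ has degree $\Delta(G)$. In particular, if every vertex of $G$ belongs to some $\gamma$-set of $G$, then $G$ is regular. (ii) If there exist a $\gamma$-set $D$ of $G$ and a vertex $y\in V(G)\setminus D$ such that $D$ is an efficient dominating set of $G-y$, $y$ is adjacent to exactly $2$ vertices of $D$, and all vertices of $D$ have degree $\Delta(G)$ in $G$, then $|V(G)|=\gamma(G)(\Delta(G)+1)-1$.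
   Context: All graphs are finite, simple and undirected; $\Delta(G)$ is the maximum degree. A dominating set of $G$ is a set $D\subseteq V(G)$ such that every vertex not in $D$ has a neighbor in $D$; $\gamma(G)$ is the minimum size of a dominating set, and a dominating set of size $\gamma(G)$ is a $\gamma$-set. An efficient dominating set of $G$ is a set $D\subseteq V(G)$ with $|N[v]\cap D|=1$ for every $v\in V(G)$, where $N[v]$ is the closed neighborhood of $v$. -}

module Defs where

open import Data.Nat using (ℕ; _⊔_; _≤_)
open import Data.Bool using (Bool; true; false; _∨_)
open import Data.Fin using (Fin)
open import Data.Fin.Properties using (_≟_)
open import Data.Fin.Subset using (Subset; _∈_; _∉_; _⊆_; _∩_; ∣_∣; ⁅_⁆; ∁; ⊤)
open import Data.Vec using (tabulate)
open import Data.List using (foldr; map; allFin)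
open import Data.Product using (Σ; _×_)
open import Relation.Binary.PropositionalEquality using (_≡_)
open import Relation.Nullary.Decidable using (⌊_⌋)

record Graph (n : ℕ) : Set where
  field
    Adj    : Fin n → Fin n → Bool
    sym    : ∀ u v → Adj u v ≡ Adj v u
    irrefl : ∀ v → Adj v v ≡ false

open Graph public

module _ {n : ℕ} (G : Graph n) where

  N : Fin n → Subset n
  N v = tabulate (λ u → Adj G v u)

  N[_] : Fin n → Subset n
  N[ v ] = tabulate (λ u → ⌊ u ≟ v ⌋ ∨ Adj G v u)

  degree : Fin n → ℕ
  degree v = ∣ N v ∣

  -- maximum degree Δ(G) (0 for the empty graph)
  Δ : ℕ
  Δ = foldr _⊔_ 0 (map degree (allFin n))

  IsDominating : Subset n → Set
  IsDominating D = ∀ v → v ∉ D → Σ (Fin n) λ u → u ∈ D × Adj G u v ≡ true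

  IsGammaSet : Subset n → Set
  IsGammaSet D = IsDominating D × (∀ D' → IsDominating D' → ∣ D ∣ ≤ ∣ D' ∣)

  IsDominationNumber : ℕ → Set
  IsDominationNumber k =
    (Σ (Subset n) λ D → IsDominating D × ∣ D ∣ ≡ k)
    × (∀ D → IsDominating D → k ≤ ∣ D ∣)

  -- D is an efficient dominating set of the induced subgraph G[S]:
  -- D ⊆ S and |N_{G[S]}[v] ∩ D| = 1 for every v ∈ S.
  IsEfficientDominatingIn : Subset n → Subset n → Set
  IsEfficientDominatingIn S D = D ⊆ S × (∀ v → v ∈ S → ∣ N[ v ] ∩ S ∩ D ∣ ≡ 1)

  IsEfficientDominating : Subset n → Set
  IsEfficientDominating D = IsEfficientDominatingIn ⊤ D

  HasEfficientDominatingSet : Set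
  HasEfficientDominatingSet = Σ (Subset n) IsEfficientDominating

  IsEfficientDominatingMinus : Fin n → Subset n → Set
  IsEfficientDominatingMinus y D = IsEfficientDominatingIn (∁ ⁅ y ⁆) D

-- Write m(v) = |N[v] ∩ D| for a dominating set D. Counting the pairs (v, u) with u ∈ D ∩ N[v]
-- in two ways gives Σ_v m(v) = Σ_{u ∈ D} (deg u + 1) ≤ |D| (Δ + 1). Every m(v) is at least 1,
-- and if all were 1 then D would be efficient; so without an efficient dominating set the
-- excess Σ_v (m(v) - 1) is positive, whence n + 1 ≤ γ (Δ + 1). When equality holds, a γ-set
-- makes both inequalities tight: its vertices have degree Δ and the excess is exactly 1, i.e.
-- one vertex y is dominated twice and all others once. Such a y lies outside D (otherwise its
-- second dominator would itself be dominated twice), so D is efficient in G - y. Conversely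
-- these conditions make both inequalities equalities.
module Submission where

open import Defs hiding (sym)
open import Data.Nat.Properties hiding (_≟_)
open import Algebra.Properties.Semiring.Sum +-*-semiring
  using (sum; sum-syntax; sum-cong-≗; sum-replicate-zero; ∑-distrib-+; ∑-comm; *-distribˡ-sum; *-distribʳ-sum)
open import Data.Bool using (Bool; true; false; _∧_; _∨_)
open import Data.Bool.Properties using (∨-zeroʳ)
open import Data.Fin using (Fin; zero; suc)
open import Data.Fin.Properties as Fin using (_≟_)
open import Data.Fin.Subset using (Subset; _∈_; _∉_; _⊆_; _∩_; ∣_∣; ⁅_⁆; ∁)
open import Data.Fin.Subset.Properties
  using ( _∈?_; ⊆⊤; ⊆-antisym; ∩-identityˡ; x∈p∩q⁺; x∈p∩q⁻; p∩q⊆q; x∈⁅x⁆; x∈⁅y⁆⇒x≡y; ∣⁅x⁆∣≡1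
        ; x≢y⇒x∉⁅y⁆; x∉⁅y⁆⇒x≢y; x∉p⇒x∈∁p; x∈∁p⇒x∉p; x∈p∧x≢y⇒x∈p-y; x∈p⇒∣p-x∣<∣p∣
        ; p⊆q⇒∣p∣≤∣q∣)
open import Data.List.Membership.Propositional.Properties using (∈-allFin; ∈-map⁺)
open import Data.List.Relation.Unary.Any using (here; there)
import Data.List.Membership.Propositional as List
open import Data.List using (List; foldr)
open import Data.Nat using (ℕ; zero; suc; _+_; _*_; _∸_; _≤_; _⊔_; z≤n; s≤s)
open import Data.Product using (Σ; _×_; _,_; proj₁)
open import Data.Vec using ([]; _∷_; lookup; tabulate)
open import Data.Vec.Properties using (lookup∘tabulate; lookup-zipWith; []=⇒lookup; lookup⇒[]=)
open import Function using (_∘_)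
open import Relation.Binary.PropositionalEquality
  using (_≡_; _≢_; refl; sym; trans; cong; cong₂; subst; module ≡-Reasoning)
open import Relation.Nullary using (¬_; yes; no; contradiction)
open import Relation.Nullary.Decidable using (⌊_⌋; isYes≗does; dec-true; dec-false)

sum-ones : ∀ n → ∑[ i < n ] 1 ≡ n
sum-ones zero    = refl
sum-ones (suc n) = cong suc (sum-ones n)

sum-mono-≤ : ∀ {n} {f g : Fin n → ℕ} → (∀ i → f i ≤ g i) → sum f ≤ sum g
sum-mono-≤ {zero}  _   = z≤n
sum-mono-≤ {suc n} f≤g = +-mono-≤ (f≤g zero) (sum-mono-≤ (f≤g ∘ suc))

sum-mono-≤-tight : ∀ {n} {f g : Fin n → ℕ} → (∀ i → f i ≤ g i) → sum g ≤ sum f → ∀ i → f i ≡ g i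
sum-mono-≤-tight {suc n} {f} {g} f≤g Σg≤Σf = λ where
    zero    → head≡
    (suc i) → sum-mono-≤-tight (f≤g ∘ suc) tail≥ i
  where
  head≡ : f zero ≡ g zero
  head≡ = ≤-antisym (f≤g zero) (+-cancelʳ-≤ (sum (f ∘ suc)) (g zero) (f zero)
            (≤-trans (+-monoʳ-≤ (g zero) (sum-mono-≤ (f≤g ∘ suc))) Σg≤Σf))
  tail≥ : sum (g ∘ suc) ≤ sum (f ∘ suc)
  tail≥ = +-cancelˡ-≤ (g zero) _ _ (subst (λ x → g zero + sum (g ∘ suc) ≤ x + sum (f ∘ suc)) head≡ Σg≤Σf)

sum≡0⇒≡0 : ∀ {n} (f : Fin n → ℕ) → sum f ≡ 0 → ∀ i → f i ≡ 0
sum≡0⇒≡0 f Σf≡0 zero    = m+n≡0⇒m≡0 (f zero) Σf≡0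
sum≡0⇒≡0 f Σf≡0 (suc i) = sum≡0⇒≡0 (f ∘ suc) (m+n≡0⇒n≡0 (f zero) Σf≡0) i

sum-single : ∀ {n} (f : Fin n → ℕ) y → (∀ i → i ≢ y → f i ≡ 0) → sum f ≡ f y
sum-single {suc n} f zero    others = trans (cong (f zero +_) Σtail≡0) (+-identityʳ (f zero))
  where
  Σtail≡0 : sum (f ∘ suc) ≡ 0
  Σtail≡0 = trans (sum-cong-≗ (λ i → others (suc i) λ ())) (sum-replicate-zero n)
sum-single         f (suc y) others =
  cong₂ _+_ (others zero λ ()) (sum-single (f ∘ suc) y λ i i≢y → others (suc i) (i≢y ∘ Fin.suc-injective))

sum≡1⇒single : ∀ {n} (f : Fin n → ℕ) → sum f ≡ 1 →
               Σ (Fin n) λ y → f y ≡ 1 × (∀ i → i ≢ y → f i ≡ 0)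
sum≡1⇒single {suc n} f Σf≡1 with f zero in f₀
... | 0 with sum≡1⇒single (f ∘ suc) Σf≡1
...   | y , fy≡1 , others = suc y , fy≡1 , λ where
          zero    _   → f₀
          (suc i) i≢y → others i (i≢y ∘ cong suc)
sum≡1⇒single {suc n} f Σf≡1 | 1 =
  zero , f₀ , λ where
    zero    0≢0 → contradiction refl 0≢0
    (suc i) _   → sum≡0⇒≡0 (f ∘ suc) (suc-injective Σf≡1) i

[_] : Bool → ℕ
[ true ]  = 1
[ false ] = 0

[∧]≡[]*[] : ∀ a b → [ a ∧ b ] ≡ [ a ] * [ b ]
[∧]≡[]*[] true  true  = refl
[∧]≡[]*[] true  false = refl
[∧]≡[]*[] false _     = refl

∣p∣≡∑[lookup] : ∀ {n} (p : Subset n) → ∣ p ∣ ≡ ∑[ i < n ] [ lookup p i ]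
∣p∣≡∑[lookup] []          = refl
∣p∣≡∑[lookup] (true ∷ p)  = cong suc (∣p∣≡∑[lookup] p)
∣p∣≡∑[lookup] (false ∷ p) = ∣p∣≡∑[lookup] p

∣tabulate∣≡∑ : ∀ {n} (f : Fin n → Bool) → ∣ tabulate f ∣ ≡ ∑[ i < n ] [ f i ]
∣tabulate∣≡∑ f = trans (∣p∣≡∑[lookup] (tabulate f)) (sum-cong-≗ (cong [_] ∘ lookup∘tabulate f))

∣tabulate∩q∣≡∑ : ∀ {n} (f : Fin n → Bool) (q : Subset n) →
                 ∣ tabulate f ∩ q ∣ ≡ ∑[ i < n ] ([ f i ] * [ lookup q i ])
∣tabulate∩q∣≡∑ f q = trans (∣p∣≡∑[lookup] (tabulate f ∩ q)) (sum-cong-≗ λ i →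
  trans (cong [_] (trans (lookup-zipWith _∧_ i (tabulate f) q) (cong (_∧ lookup q i) (lookup∘tabulate f i))))
        ([∧]≡[]*[] (f i) (lookup q i)))

∑[lookup]*≡∣p∣* : ∀ {n} (p : Subset n) c → ∑[ i < n ] ([ lookup p i ] * c) ≡ ∣ p ∣ * c
∑[lookup]*≡∣p∣* p c = sym (trans (cong (_* c) (∣p∣≡∑[lookup] p)) (*-distribʳ-sum c (λ i → [ lookup p i ])))

∈tabulate⁺ : ∀ {n} {f : Fin n → Bool} {i} → f i ≡ true → i ∈ tabulate f
∈tabulate⁺ {f = f} {i} fi = lookup⇒[]= i (tabulate f) (trans (lookup∘tabulate f i) fi)

∈tabulate⁻ : ∀ {n} {f : Fin n → Bool} {i} → i ∈ tabulate f → f i ≡ true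
∈tabulate⁻ {f = f} {i} i∈ = trans (sym (lookup∘tabulate f i)) ([]=⇒lookup i∈)

x∈p⇒1≤∣p∣ : ∀ {n} {p : Subset n} {x} → x ∈ p → 1 ≤ ∣ p ∣
x∈p⇒1≤∣p∣ x∈p = ≤-trans (s≤s z≤n) (x∈p⇒∣p-x∣<∣p∣ x∈p)

x,y∈p⇒2≤∣p∣ : ∀ {n} {p : Subset n} {x y} → x ∈ p → y ∈ p → x ≢ y → 2 ≤ ∣ p ∣
x,y∈p⇒2≤∣p∣ x∈p y∈p x≢y =
  ≤-trans (s≤s (x∈p⇒1≤∣p∣ (x∈p∧x≢y⇒x∈p-y x∈p x≢y))) (x∈p⇒∣p-x∣<∣p∣ y∈p)

∁⁅y⁆∩p≡p : ∀ {n} {p : Subset n} {y} → y ∉ p → ∁ ⁅ y ⁆ ∩ p ≡ p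
∁⁅y⁆∩p≡p {p = p} {y} y∉p = ⊆-antisym (p∩q⊆q _ p) λ x∈p →
  x∈p∩q⁺ (x∉p⇒x∈∁p (λ x∈⁅y⁆ → y∉p (subst (_∈ p) (x∈⁅y⁆⇒x≡y y x∈⁅y⁆) x∈p)) , x∈p)

⌊x≟x⌋≡true : ∀ {n} (x : Fin n) → ⌊ x ≟ x ⌋ ≡ true
⌊x≟x⌋≡true x = trans (isYes≗does (x ≟ x)) (dec-true (x ≟ x) refl)

⌊x≟y⌋≡false : ∀ {n} {x y : Fin n} → x ≢ y → ⌊ x ≟ y ⌋ ≡ false
⌊x≟y⌋≡false {x = x} {y} x≢y = trans (isYes≗does (x ≟ y)) (dec-false (x ≟ y) x≢y)

≤foldr-⊔ : ∀ {x} {xs : List ℕ} → x List.∈ xs → x ≤ foldr _⊔_ 0 xs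
≤foldr-⊔ (here refl) = m≤m⊔n _ _
≤foldr-⊔ (there x∈) = ≤-trans (≤foldr-⊔ x∈) (m≤n⊔m _ _)

module DominationCounting {n : ℕ} (G : Graph n) where

  closedAdj : Fin n → Fin n → Bool
  closedAdj v u = ⌊ u ≟ v ⌋ ∨ Adj G v u

  closedAdj-sym : ∀ v u → closedAdj v u ≡ closedAdj u v
  closedAdj-sym v u with u ≟ v | v ≟ u
  ... | yes _   | yes _   = refl
  ... | no _    | no _    = Graph.sym G v u
  ... | yes u≡v | no v≢u  = contradiction (sym u≡v) v≢u
  ... | no u≢v  | yes v≡u = contradiction (sym v≡u) u≢v

  v∈N[v] : ∀ v → v ∈ N[ G ] v
  v∈N[v] v = ∈tabulate⁺ (cong (_∨ Adj G v v) (⌊x≟x⌋≡true v))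

  adj⇒∈N[] : ∀ {v u} → Adj G v u ≡ true → u ∈ N[ G ] v
  adj⇒∈N[] {v} {u} adj = ∈tabulate⁺ (trans (cong (⌊ u ≟ v ⌋ ∨_) adj) (∨-zeroʳ _))

  ∈N[]-sym : ∀ {v u} → u ∈ N[ G ] v → v ∈ N[ G ] u
  ∈N[]-sym {v} {u} u∈ = ∈tabulate⁺ (trans (sym (closedAdj-sym v u)) (∈tabulate⁻ u∈))

  ∈N[]⁻ : ∀ {v u} → u ∈ N[ G ] v → u ≢ v → Adj G v u ≡ true
  ∈N[]⁻ {v} {u} u∈ u≢v with u ≟ v | ∈tabulate⁻ {f = closedAdj v} u∈
  ... | yes u≡v | _   = contradiction u≡v u≢v
  ... | no _    | adj = adj

  N∩p≡N[]∩p : ∀ {p : Subset n} {y} → y ∉ p → N G y ∩ p ≡ N[ G ] y ∩ p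
  N∩p≡N[]∩p {p} {y} y∉p = ⊆-antisym
    (λ u∈ → let u∈N , u∈p = x∈p∩q⁻ _ p u∈ in x∈p∩q⁺ (adj⇒∈N[] (∈tabulate⁻ u∈N) , u∈p))
    (λ {u} u∈ → let u∈N[] , u∈p = x∈p∩q⁻ _ p u∈
                    u≢y = λ u≡y → y∉p (subst (_∈ p) u≡y u∈p)
                in x∈p∩q⁺ (∈tabulate⁺ (∈N[]⁻ u∈N[] u≢y) , u∈p))

  ∑closedAdj≡degree+1 : ∀ v → ∑[ u < n ] [ closedAdj v u ] ≡ degree G v + 1
  ∑closedAdj≡degree+1 v = begin
    ∑[ u < n ] [ closedAdj v u ]
      ≡⟨ sum-cong-≗ split ⟩
    ∑[ u < n ] ([ ⌊ u ≟ v ⌋ ] + [ Adj G v u ])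
      ≡⟨ ∑-distrib-+ (λ u → [ ⌊ u ≟ v ⌋ ]) (λ u → [ Adj G v u ]) ⟩
    ∑[ u < n ] [ ⌊ u ≟ v ⌋ ] + ∑[ u < n ] [ Adj G v u ]
      ≡⟨ cong₂ _+_ (sym Σself≡1) (∣tabulate∣≡∑ (Adj G v)) ⟨
    1 + degree G v
      ≡⟨ +-comm 1 (degree G v) ⟩
    degree G v + 1
      ∎
    where
    open ≡-Reasoning
    split : ∀ u → [ closedAdj v u ] ≡ [ ⌊ u ≟ v ⌋ ] + [ Adj G v u ]
    split u with u ≟ v
    ... | yes refl rewrite irrefl G u = refl
    ... | no _ = refl
    Σself≡1 : ∑[ u < n ] [ ⌊ u ≟ v ⌋ ] ≡ 1
    Σself≡1 = trans (sum-single _ v (λ u u≢v → cong [_] (⌊x≟y⌋≡false u≢v))) (cong [_] (⌊x≟x⌋≡true v))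

  degree≤Δ : ∀ v → degree G v ≤ Δ G
  degree≤Δ v = ≤foldr-⊔ (∈-map⁺ (degree G) (∈-allFin v))

  domCount : Subset n → Fin n → ℕ
  domCount D v = ∣ N[ G ] v ∩ D ∣

  excess : Subset n → Fin n → ℕ
  excess D v = domCount D v ∸ 1

  ∑domCount≡∑[deg+1] : ∀ D → ∑[ v < n ] domCount D v ≡ ∑[ u < n ] ([ lookup D u ] * (degree G u + 1))
  ∑domCount≡∑[deg+1] D = begin
    ∑[ v < n ] domCount D v
      ≡⟨ sum-cong-≗ (λ v → ∣tabulate∩q∣≡∑ (closedAdj v) D) ⟩
    ∑[ v < n ] ∑[ u < n ] ([ closedAdj v u ] * [ lookup D u ])
      ≡⟨ ∑-comm (λ v u → [ closedAdj v u ] * [ lookup D u ]) ⟩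
    ∑[ u < n ] ∑[ v < n ] ([ closedAdj v u ] * [ lookup D u ])
      ≡⟨ sum-cong-≗ (λ u → sum-cong-≗ (swap u)) ⟩
    ∑[ u < n ] ∑[ v < n ] ([ lookup D u ] * [ closedAdj u v ])
      ≡⟨ sum-cong-≗ (λ u → *-distribˡ-sum [ lookup D u ] ([_] ∘ closedAdj u)) ⟨
    ∑[ u < n ] ([ lookup D u ] * ∑[ v < n ] [ closedAdj u v ])
      ≡⟨ sum-cong-≗ (λ u → cong ([ lookup D u ] *_) (∑closedAdj≡degree+1 u)) ⟩
    ∑[ u < n ] ([ lookup D u ] * (degree G u + 1))
      ∎
    where
    open ≡-Reasoning
    swap : ∀ u v → [ closedAdj v u ] * [ lookup D u ] ≡ [ lookup D u ] * [ closedAdj u v ]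
    swap u v = trans (*-comm [ closedAdj v u ] [ lookup D u ])
                     (cong (λ b → [ lookup D u ] * [ b ]) (closedAdj-sym v u))

  termwise≤ : ∀ D u → [ lookup D u ] * (degree G u + 1) ≤ [ lookup D u ] * (Δ G + 1)
  termwise≤ D u = *-monoʳ-≤ [ lookup D u ] (+-monoˡ-≤ 1 (degree≤Δ u))

  ∑domCount≤∣D∣*[Δ+1] : ∀ D → ∑[ v < n ] domCount D v ≤ ∣ D ∣ * (Δ G + 1)
  ∑domCount≤∣D∣*[Δ+1] D = begin
    ∑[ v < n ] domCount D v                        ≡⟨ ∑domCount≡∑[deg+1] D ⟩
    ∑[ u < n ] ([ lookup D u ] * (degree G u + 1)) ≤⟨ sum-mono-≤ (termwise≤ D) ⟩
    ∑[ u < n ] ([ lookup D u ] * (Δ G + 1))        ≡⟨ ∑[lookup]*≡∣p∣* D (Δ G + 1) ⟩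
    ∣ D ∣ * (Δ G + 1)                              ∎
    where open ≤-Reasoning

  ∑domCount≡∣D∣*[Δ+1]⇒degree≡Δ : ∀ {D} → ∑[ v < n ] domCount D v ≡ ∣ D ∣ * (Δ G + 1) →
                                 ∀ u → u ∈ D → degree G u ≡ Δ G
  ∑domCount≡∣D∣*[Δ+1]⇒degree≡Δ {D} tight u u∈D = +-cancelʳ-≡ 1 _ _ (begin
    degree G u + 1                     ≡⟨ *-identityˡ _ ⟨
    1 * (degree G u + 1)               ≡⟨ cong (_* _) [u∈D]≡1 ⟨
    [ lookup D u ] * (degree G u + 1)  ≡⟨ termwise u ⟩
    [ lookup D u ] * (Δ G + 1)         ≡⟨ cong (_* _) [u∈D]≡1 ⟩
    1 * (Δ G + 1)                      ≡⟨ *-identityˡ _ ⟩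
    Δ G + 1                            ∎)
    where
    open ≡-Reasoning
    [u∈D]≡1 : [ lookup D u ] ≡ 1
    [u∈D]≡1 = cong [_] ([]=⇒lookup u∈D)
    termwise : ∀ u → [ lookup D u ] * (degree G u + 1) ≡ [ lookup D u ] * (Δ G + 1)
    termwise = sum-mono-≤-tight (termwise≤ D)
      (≤-reflexive (trans (∑[lookup]*≡∣p∣* D (Δ G + 1)) (trans (sym tight) (∑domCount≡∑[deg+1] D))))

  degree≡Δ⇒∑domCount≡∣D∣*[Δ+1] : ∀ {D} → (∀ u → u ∈ D → degree G u ≡ Δ G) →
                                 ∑[ v < n ] domCount D v ≡ ∣ D ∣ * (Δ G + 1)
  degree≡Δ⇒∑domCount≡∣D∣*[Δ+1] {D} maxDeg =
    trans (∑domCount≡∑[deg+1] D) (trans (sum-cong-≗ termwise) (∑[lookup]*≡∣p∣* D (Δ G + 1)))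
    where
    termwise : ∀ u → [ lookup D u ] * (degree G u + 1) ≡ [ lookup D u ] * (Δ G + 1)
    termwise u with lookup D u in u∈D
    ... | true  = cong (λ d → 1 * (d + 1)) (maxDeg u (lookup⇒[]= u D u∈D))
    ... | false = refl

  dominating⇒1≤domCount : ∀ {D} → IsDominating G D → ∀ v → 1 ≤ domCount D v
  dominating⇒1≤domCount {D} dom v with v ∈? D
  ... | yes v∈D = x∈p⇒1≤∣p∣ (x∈p∩q⁺ (v∈N[v] v , v∈D))
  ... | no v∉D with dom v v∉D
  ...   | u , u∈D , adj = x∈p⇒1≤∣p∣ (x∈p∩q⁺ (adj⇒∈N[] (trans (Graph.sym G v u) adj) , u∈D))

  domCount≡1+excess : ∀ {D} → IsDominating G D → ∀ v → domCount D v ≡ 1 + excess D v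
  domCount≡1+excess dom v = sym (m+[n∸m]≡n (dominating⇒1≤domCount dom v))

  ∑domCount≡n+∑excess : ∀ {D} → IsDominating G D → ∑[ v < n ] domCount D v ≡ n + ∑[ v < n ] excess D v
  ∑domCount≡n+∑excess {D} dom =
    trans (sum-cong-≗ (domCount≡1+excess dom))
          (trans (∑-distrib-+ (λ _ → 1) (excess D)) (cong (_+ sum (excess D)) (sum-ones n)))

  n+∑excess≤∣D∣*[Δ+1] : ∀ {D} → IsDominating G D → n + ∑[ v < n ] excess D v ≤ ∣ D ∣ * (Δ G + 1)
  n+∑excess≤∣D∣*[Δ+1] {D} dom =
    ≤-trans (≤-reflexive (sym (∑domCount≡n+∑excess dom))) (∑domCount≤∣D∣*[Δ+1] D)

  domCount≡1⇒efficient : ∀ {D} → (∀ v → domCount D v ≡ 1) → IsEfficientDominating G D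
  domCount≡1⇒efficient {D} once = ⊆⊤ , λ v _ → trans (cong (λ q → domCount q v) (∩-identityˡ D)) (once v)

  noEfficient⇒1≤∑excess : ¬ HasEfficientDominatingSet G → ∀ {D} → IsDominating G D → 1 ≤ ∑[ v < n ] excess D v
  noEfficient⇒1≤∑excess noEff {D} dom = n≢0⇒n>0 λ Σexcess≡0 →
    noEff (D , domCount≡1⇒efficient λ v →
      trans (domCount≡1+excess dom v) (cong suc (sum≡0⇒≡0 (excess D) Σexcess≡0 v)))

  efficientMinus⇒domCount≡1 : ∀ {D y} → y ∉ D → IsEfficientDominatingMinus G y D →
                              ∀ v → v ≢ y → domCount D v ≡ 1
  efficientMinus⇒domCount≡1 {D} y∉D (_ , once) v v≢y =
    trans (cong (λ q → domCount q v) (sym (∁⁅y⁆∩p≡p y∉D))) (once v (x∉p⇒x∈∁p (x≢y⇒x∉⁅y⁆ v≢y)))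

  domCount≡1⇒efficientMinus : ∀ {D y} → y ∉ D → (∀ v → v ≢ y → domCount D v ≡ 1) →
                              IsEfficientDominatingMinus G y D
  domCount≡1⇒efficientMinus {D} y∉D once =
    (λ x∈D → proj₁ (x∈p∩q⁻ _ D (subst (_ ∈_) (sym (∁⁅y⁆∩p≡p y∉D)) x∈D))) ,
    λ v v∈ → trans (cong (λ q → domCount q v) (∁⁅y⁆∩p≡p y∉D)) (once v (x∉⁅y⁆⇒x≢y (x∈∁p⇒x∉p v∈)))

  DominatedTwiceOnlyAt : Subset n → Fin n → Set
  DominatedTwiceOnlyAt D y = domCount D y ≡ 2 × (∀ v → v ≢ y → domCount D v ≡ 1)

  ∑excess≡1⇒dominatedTwiceOnlyAt : ∀ {D} → IsDominating G D → ∑[ v < n ] excess D v ≡ 1 →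
                                   Σ (Fin n) (DominatedTwiceOnlyAt D)
  ∑excess≡1⇒dominatedTwiceOnlyAt {D} dom Σexcess≡1 with sum≡1⇒single (excess D) Σexcess≡1
  ... | y , excess-y≡1 , others =
    y , trans (domCount≡1+excess dom y) (cong suc excess-y≡1) ,
    λ v v≢y → trans (domCount≡1+excess dom v) (cong suc (others v v≢y))

  dominatedTwiceOnlyAt⇒∑excess≡1 : ∀ {D y} → DominatedTwiceOnlyAt D y → ∑[ v < n ] excess D v ≡ 1
  dominatedTwiceOnlyAt⇒∑excess≡1 {D} {y} (twice , once) =
    trans (sum-single (excess D) y (λ v v≢y → cong (_∸ 1) (once v v≢y))) (cong (_∸ 1) twice)

  -- A second dominator u ≠ y of y ∈ D would have both u and y in N[u] ∩ D.
  dominatedTwiceOnlyAt⇒∉ : ∀ {D y} → DominatedTwiceOnlyAt D y → y ∉ D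
  dominatedTwiceOnlyAt⇒∉ {D} {y} (twice , once) y∈D = 1+n≰n (begin
    2              ≡⟨ twice ⟨
    domCount D y   ≤⟨ p⊆q⇒∣p∣≤∣q∣ N[y]∩D⊆⁅y⁆ ⟩
    ∣ ⁅ y ⁆ ∣      ≡⟨ ∣⁅x⁆∣≡1 y ⟩
    1              ∎)
    where
    open ≤-Reasoning
    N[y]∩D⊆⁅y⁆ : N[ G ] y ∩ D ⊆ ⁅ y ⁆
    N[y]∩D⊆⁅y⁆ {u} u∈ with u ≟ y
    ... | yes refl = x∈⁅x⁆ y
    ... | no u≢y   =
      let u∈N[y] , u∈D = x∈p∩q⁻ _ D u∈
          2≤domCount-u = x,y∈p⇒2≤∣p∣ (x∈p∩q⁺ (v∈N[v] u , u∈D)) (x∈p∩q⁺ (∈N[]-sym u∈N[y] , y∈D))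
                                     u≢y
      in contradiction (subst (2 ≤_) (once u u≢y) 2≤domCount-u) 1+n≰n

  dominatedTwiceOnlyAt⇒uniqueEfficientMinus : ∀ {D y} → DominatedTwiceOnlyAt D y →
    (y ∉ D × IsEfficientDominatingMinus G y D × ∣ N G y ∩ D ∣ ≡ 2)
    × (∀ z → z ∉ D → IsEfficientDominatingMinus G z D → z ≡ y)
  dominatedTwiceOnlyAt⇒uniqueEfficientMinus {D} {y} twiceOnly@(twice , once) =
    (y∉D , domCount≡1⇒efficientMinus y∉D once , trans (cong ∣_∣ (N∩p≡N[]∩p y∉D)) twice) , unique
    where
    y∉D : y ∉ D
    y∉D = dominatedTwiceOnlyAt⇒∉ twiceOnly
    unique : ∀ z → z ∉ D → IsEfficientDominatingMinus G z D → z ≡ y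
    unique z z∉D eff with z ≟ y
    ... | yes z≡y = z≡y
    ... | no z≢y  = contradiction (trans (sym twice) (efficientMinus⇒domCount≡1 z∉D eff y (z≢y ∘ sym))) λ ()

  efficientMinus⇒dominatedTwiceOnlyAt : ∀ {D y} → y ∉ D → IsEfficientDominatingMinus G y D →
                                        ∣ N G y ∩ D ∣ ≡ 2 → DominatedTwiceOnlyAt D y
  efficientMinus⇒dominatedTwiceOnlyAt y∉D eff ∣N∩D∣≡2 =
    trans (cong ∣_∣ (sym (N∩p≡N[]∩p y∉D))) ∣N∩D∣≡2 , efficientMinus⇒domCount≡1 y∉D eff

  module _ (noEff : ¬ HasEfficientDominatingSet G) {D} (dom : IsDominating G D) where

    n+1≤∣D∣*[Δ+1] : n + 1 ≤ ∣ D ∣ * (Δ G + 1)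
    n+1≤∣D∣*[Δ+1] = ≤-trans (+-monoʳ-≤ n (noEfficient⇒1≤∑excess noEff dom)) (n+∑excess≤∣D∣*[Δ+1] dom)

    module _ (tight : ∣ D ∣ * (Δ G + 1) ≡ n + 1) where

      tight⇒∑excess≡1 : ∑[ v < n ] excess D v ≡ 1
      tight⇒∑excess≡1 = ≤-antisym
        (+-cancelˡ-≤ n (∑[ v < n ] excess D v) 1 (≤-trans (n+∑excess≤∣D∣*[Δ+1] dom) (≤-reflexive tight)))
        (noEfficient⇒1≤∑excess noEff dom)

      tight⇒dominatedTwiceOnlyAt : Σ (Fin n) (DominatedTwiceOnlyAt D)
      tight⇒dominatedTwiceOnlyAt = ∑excess≡1⇒dominatedTwiceOnlyAt dom tight⇒∑excess≡1

      tight⇒degree≡Δ : ∀ u → u ∈ D → degree G u ≡ Δ G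
      tight⇒degree≡Δ = ∑domCount≡∣D∣*[Δ+1]⇒degree≡Δ
        (trans (∑domCount≡n+∑excess dom) (trans (cong (n +_) tight⇒∑excess≡1) (sym tight)))

  dominatedTwiceOnlyAt⇒tight : ∀ {D y} → IsDominating G D → DominatedTwiceOnlyAt D y →
                               (∀ u → u ∈ D → degree G u ≡ Δ G) → ∣ D ∣ * (Δ G + 1) ≡ n + 1
  dominatedTwiceOnlyAt⇒tight {D} dom twiceOnly maxDeg = begin
    ∣ D ∣ * (Δ G + 1)          ≡⟨ degree≡Δ⇒∑domCount≡∣D∣*[Δ+1] maxDeg ⟨
    ∑[ v < n ] domCount D v    ≡⟨ ∑domCount≡n+∑excess dom ⟩
    n + ∑[ v < n ] excess D v  ≡⟨ cong (n +_) (dominatedTwiceOnlyAt⇒∑excess≡1 twiceOnly) ⟩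
    n + 1                      ∎
    where open ≡-Reasoning

theorem3p9 : ∀ {n : ℕ} (G : Graph n) (γ : ℕ) → IsDominationNumber G γ →
    ¬ HasEfficientDominatingSet G →
    (n ≤ γ * (Δ G + 1) ∸ 1)
    × (n ≡ γ * (Δ G + 1) ∸ 1 →
        (∀ (D : Subset n) → IsGammaSet G D →
           Σ (Fin n) λ y →
             (y ∉ D × IsEfficientDominatingMinus G y D × ∣ N G y ∩ D ∣ ≡ 2)
             × (∀ (z : Fin n) → z ∉ D → IsEfficientDominatingMinus G z D → z ≡ y))
        × (∀ (v : Fin n) → Σ (Subset n) (λ D → IsGammaSet G D × v ∈ D) → degree G v ≡ Δ G)
        × ((∀ (v : Fin n) → Σ (Subset n) λ D → IsGammaSet G D × v ∈ D) →
           ∀ (u v : Fin n) → degree G u ≡ degree G v))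
    × (∀ (D : Subset n) (y : Fin n) → IsGammaSet G D → y ∉ D →
        IsEfficientDominatingMinus G y D → ∣ N G y ∩ D ∣ ≡ 2 →
        (∀ (v : Fin n) → v ∈ D → degree G v ≡ Δ G) →
        n ≡ γ * (Δ G + 1) ∸ 1)
theorem3p9 {n} G γ ((D₀ , D₀-dominating , ∣D₀∣≡γ) , γ-minimum) noEff =
  m+n≤o⇒m≤o∸n n n+1≤γ[Δ+1] ,
  (λ equality →
    (λ D γ-set → let y , twiceOnly = tight⇒dominatedTwiceOnlyAt noEff (proj₁ γ-set) (tight equality γ-set)
                 in y , dominatedTwiceOnlyAt⇒uniqueEfficientMinus twiceOnly) ,
    maximumDegree equality ,
    λ covered u v → trans (maximumDegree equality u (covered u)) (sym (maximumDegree equality v (covered v)))) ,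
  λ D y γ-set y∉D eff ∣N∩D∣≡2 maxDeg → sym (begin
    γ * (Δ G + 1) ∸ 1      ≡⟨ cong (λ k → k * (Δ G + 1) ∸ 1) (∣γ-set∣≡γ γ-set) ⟨
    ∣ D ∣ * (Δ G + 1) ∸ 1  ≡⟨ cong (_∸ 1) (dominatedTwiceOnlyAt⇒tight (proj₁ γ-set)
                                 (efficientMinus⇒dominatedTwiceOnlyAt y∉D eff ∣N∩D∣≡2) maxDeg) ⟩
    n + 1 ∸ 1              ≡⟨ m+n∸n≡m n 1 ⟩
    n                      ∎)
  where
  open DominationCounting G
  open ≡-Reasoning

  ∣γ-set∣≡γ : ∀ {D} → IsGammaSet G D → ∣ D ∣ ≡ γ
  ∣γ-set∣≡γ {D} (dominating , minimum) =
    ≤-antisym (subst (∣ D ∣ ≤_) ∣D₀∣≡γ (minimum D₀ D₀-dominating)) (γ-minimum D dominating)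

  n+1≤γ[Δ+1] : n + 1 ≤ γ * (Δ G + 1)
  n+1≤γ[Δ+1] = subst (λ k → n + 1 ≤ k * (Δ G + 1)) ∣D₀∣≡γ (n+1≤∣D∣*[Δ+1] noEff D₀-dominating)

  tight : n ≡ γ * (Δ G + 1) ∸ 1 → ∀ {D} → IsGammaSet G D → ∣ D ∣ * (Δ G + 1) ≡ n + 1
  tight equality γ-set = trans (cong (_* (Δ G + 1)) (∣γ-set∣≡γ γ-set))
    (trans (sym (m∸n+n≡m (m+n≤o⇒n≤o n n+1≤γ[Δ+1]))) (cong (_+ 1) (sym equality)))

  maximumDegree : n ≡ γ * (Δ G + 1) ∸ 1 →
                  ∀ v → Σ (Subset n) (λ D → IsGammaSet G D × v ∈ D) → degree G v ≡ Δ G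
  maximumDegree equality v (D , γ-set , v∈D) =
    tight⇒degree≡Δ noEff (proj₁ γ-set) (tight equality γ-set) v v∈D
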